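{- Let $f:2^{\mathcal{N}}\to\mathbb{Z}_{\ge0}$ be a polymatroid with $f(\{e\})>0$ for every $e\in\mathcal{N}$, and let $\mathcal{N}=S_0\supseteq S_1\supseteq\dots\supseteq S_w=\emptyset$ be a strength decomposition of $\mathcal{N}$ with respect to $f$. Then $(f(S_i))_{i=0}^{w}$ is a strictly decreasing integer sequence.
   Context: A polymatroid is an integer-valued, monotone, submodular set function with value $0$ on the empty set. For $T\subseteq S\subseteq\mathcal{N}$, the strength-ratio is $\varphi(T|S)=\frac{|S|-|T|}{f(S)-f(T)}$, with the convention $x/0=+\infty$ for $x\ge0$. A strength decomposition of $\mathcal{N}$ with respect to $f$ is a sequence $S_0\supseteq S_1\supseteq\dots\supseteq S_w$ such that $S_0=\mathcal{N}$; $S_w=\emptyset$ and $S_i\ne\emptyset$ for $i\in[0,w-1]$; for every $i\in[w]$, $S_i$ minimizes $\varphi(S|S_{i-1})$ over $S\subseteq S_{i-1}$; and the ratios $\varphi(S_i|S_{i-1})$ are nondecreasing in $i$. -}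

module Defs where

open import Data.Nat using (ℕ; zero; suc; _∸_; _≤_; _<_)
open import Data.Integer using (+_)
open import Data.Rational using (ℚ; _/_) renaming (_≤_ to _≤ℚ_)
open import Data.Fin using (Fin)
open import Data.Fin.Subset using (Subset; _⊆_; _∪_; _∩_; ⊥; ⊤; ∣_∣; ⁅_⁆)
open import Data.Nat using (_+_)
open import Data.Empty using () renaming (⊥ to Empty)
open import Data.Unit using () renaming (⊤ to Unit)
open import Relation.Binary.PropositionalEquality using (_≡_; _≢_)

record IsPolymatroid {n : ℕ} (f : Subset n → ℕ) : Set where
  field
    empty      : f ⊥ ≡ 0
    monotone   : ∀ {S T} → S ⊆ T → f S ≤ f T
    submodular : ∀ S T → f (S ∪ T) + f (S ∩ T) ≤ f S + f T

data ℚ∞ : Set where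
  fin : ℚ → ℚ∞
  ∞   : ℚ∞

infix 4 _≤∞_
_≤∞_ : ℚ∞ → ℚ∞ → Set
fin p ≤∞ fin q = p ≤ℚ q
fin p ≤∞ ∞     = Unit
∞     ≤∞ fin q = Empty
∞     ≤∞ ∞     = Unit

_÷∞_ : ℕ → ℕ → ℚ∞
x ÷∞ zero  = ∞
x ÷∞ suc k = fin ((+ x) / suc k)

-- strength-ratio φ(T|S) = (|S| - |T|) / (f(S) - f(T))   (used for T ⊆ S,
-- where both differences are nonnegative, so truncated ∸ is exact)
φ : {n : ℕ} → (Subset n → ℕ) → Subset n → Subset n → ℚ∞
φ f T S = (∣ S ∣ ∸ ∣ T ∣) ÷∞ (f S ∸ f T)

-- Strength decomposition S₀ ⊇ S₁ ⊇ … ⊇ S_w, given as a sequence ℕ → Subset n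
-- (only indices 0..w matter).
record IsStrengthDecomposition {n : ℕ} (f : Subset n → ℕ)
         (w : ℕ) (S : ℕ → Subset n) : Set where
  field
    first    : S 0 ≡ ⊤
    last     : S w ≡ ⊥
    nonempty : ∀ i → i < w → S i ≢ ⊥
    chain    : ∀ i → i < w → S (suc i) ⊆ S i
    minimal  : ∀ i → i < w → ∀ T → T ⊆ S i →
                 φ f (S (suc i)) (S i) ≤∞ φ f T (S i)
    ordered  : ∀ i → suc i < w →
                 φ f (S (suc i)) (S i) ≤∞ φ f (S (suc (suc i))) (S (suc i))

{-# OPTIONS --safe #-}
-- If f(S_i) = f(S_{i+1}), the minimal ratio φ(S_{i+1} | S_i) is +∞, so every
-- T ⊆ S_i has φ(T | S_i) = +∞; taking T = ∅ forces f(S_i) = 0. But S_i is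
-- nonempty, so by monotonicity f(S_i) ≥ f({e}) > 0 for some e ∈ S_i.
module Submission where

open import Defs
open import Data.Nat using (ℕ; zero; suc; _<_; _≤_; _∸_)
open import Data.Nat.Properties using (≰⇒>; m≤n⇒m∸n≡0; <-≤-trans; <⇒≢)
open import Data.Fin using (Fin)
open import Data.Fin.Subset using (Subset; ⁅_⁆; _∈_; _⊆_; ⊥; ∣_∣)
open import Data.Fin.Subset.Properties using (nonempty?; Empty-unique; x∈⁅y⁆⇒x≡y; ⊥⊆)
open import Data.Product using (_,_)
open import Relation.Nullary using (yes; no; contradiction)
open import Relation.Binary.PropositionalEquality using (_≡_; _≢_; refl; sym; subst)

∞≤÷∞⇒divisor≡0 : ∀ x d → ∞ ≤∞ x ÷∞ d → d ≡ 0
∞≤÷∞⇒divisor≡0 _ zero    _  = refl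
∞≤÷∞⇒divisor≡0 _ (suc d) ()

⁅⁆⊆ : ∀ {n} {e : Fin n} {S : Subset n} → e ∈ S → ⁅ e ⁆ ⊆ S
⁅⁆⊆ {S = S} e∈S x∈⁅e⁆ = subst (_∈ S) (sym (x∈⁅y⁆⇒x≡y _ x∈⁅e⁆)) e∈S

monotone⇒positive-on-nonempty : ∀ {n} {f : Subset n → ℕ} →
  (∀ {S T} → S ⊆ T → f S ≤ f T) → (∀ e → 0 < f ⁅ e ⁆) →
  ∀ {S} → S ≢ ⊥ → 0 < f S
monotone⇒positive-on-nonempty monotone pos {S} S≢⊥ with nonempty? S
... | yes (e , e∈S) = <-≤-trans (pos e) (monotone (⁅⁆⊆ e∈S))
... | no  S-empty   = contradiction (Empty-unique S-empty) S≢⊥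

flat-minimiser⇒≡0 : ∀ {n} {f : Subset n → ℕ} → IsPolymatroid f →
  ∀ {S S′} → (∀ T → T ⊆ S → φ f S′ S ≤∞ φ f T S) → f S ≤ f S′ → f S ≡ 0
flat-minimiser⇒≡0 {f = f} P {S} {S′} minimal flat =
  subst (λ z → f S ∸ z ≡ 0) empty (∞≤÷∞⇒divisor≡0 _ _ ∞≤φ⊥)
  where
  open IsPolymatroid P
  ∞≤φ⊥ : ∞ ≤∞ φ f ⊥ S
  ∞≤φ⊥ = subst (λ d → (∣ S ∣ ∸ ∣ S′ ∣) ÷∞ d ≤∞ φ f ⊥ S) (m≤n⇒m∸n≡0 flat) (minimal ⊥ ⊥⊆)

lemma4p3 : (n : ℕ) (f : Subset n → ℕ) → IsPolymatroid f →
    (∀ (e : Fin n) → 0 < f ⁅ e ⁆) →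
    (w : ℕ) (S : ℕ → Subset n) → IsStrengthDecomposition f w S →
    ∀ i → i < w → f (S (suc i)) < f (S i)
lemma4p3 _ f P pos _ S D i i<w = ≰⇒> λ flat →
  <⇒≢ (monotone⇒positive-on-nonempty monotone pos (nonempty i i<w))
      (sym (flat-minimiser⇒≡0 P (minimal i i<w) flat))
  where
  open IsPolymatroid P
  open IsStrengthDecomposition D
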